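{- Let $n$ be an even positive integer, $p\ne2$ a prime, and $p^a$ the largest power of $p$ dividing $n$. Suppose there is a prime $q$ with $n/3<q<n/2$ and $n-2q<p^a$. Then for every prime $r$ dividing $\binom{n}{n/2}$, every binomial coefficient $\binom{n}{k}$ with $1\le k\le n-1$ is divisible by at least one of $p$, $q$, $r$ (so $n$ satisfies the $3$-variation of Condition 1 with $p$, $q$ and $r$).
   Context: A positive integer $n$ satisfies the $N$-variation of Condition 1 if there exist $N$ distinct primes such that for every $k$ with $1\le k\le n-1$, $\binom{n}{k}$ is divisible by at least one of them. -}

module Defs where

module Submission where

-- Suppose p ∤ C(n, k).  From k·C(n, k) = n·C(n−1, k−1) the power
-- p^a ∣ n passes to k, and p^a ∣ m as p is odd.  Now locate k in [1, n−1]: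
--   * k ∈ [0, s], [q, q+s] or [2q, 2q+s]: a window of length s < p^a holds
--     at most one multiple of p^a, and these windows already hold 0, m, n;
--     so k = m (then r ∣ C(n, k)), the other two being excluded.
--   * s < k < q or q+s < k < 2q: one of k, n−k is below q and the other
--     below 2q, so q² ∣ n! while q² ∤ k!·(n−k)!, whence q ∣ C(n, k).

open import Defs
open import Data.Nat using (ℕ; suc; _+_; _*_; _∸_; _^_; _≤_; _<_)
open import Data.Nat.Divisibility using (_∣_)
open import Data.Nat.Primality using (Prime)
open import Data.Nat.Combinatorics using (_C_)
open import Data.Product using (_×_)
open import Data.Sum using (_⊎_)
open import Relation.Nullary using (¬_)
open import Relation.Binary.PropositionalEquality using (_≡_)

open import Data.Nat using (zero; _!; z≤n; s≤s; NonZero; >-nonZero; nonTrivial⇒n>1; _≤?_; _<?_)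
open import Data.Nat.Properties
open import Data.Nat.Divisibility
  using (divides; ∣-trans; ∣⇒≤; _∣?_; ∣m+n∣m⇒∣n; m∣m*n; n∣m*n; ∣m⇒∣m*n; 1∣_; ∣1⇒≡1;
         *-monoʳ-∣; *-cancelˡ-∣; *-pres-∣; m≤n⇒m!∣n!)
open import Data.Nat.DivMod using (m/n*n≡m)
open import Data.Nat.Primality using (euclidsLemma; prime⇒nonZero; prime⇒nonTrivial)
open import Data.Nat.Combinatorics
  using (k![n∸k]!∣n!; nCk≡n!/k![n-k]!; nCk≡nC[n∸k])
open import Data.Nat.Tactic.RingSolver using (solve-∀)
open import Data.Product using (_,_; proj₁; proj₂)
open import Data.Sum using (inj₁; inj₂)
open import Data.Empty using (⊥-elim)
open import Relation.Nullary using (yes; no)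
open import Relation.Binary.PropositionalEquality
  using (refl; sym; trans; cong; subst; module ≡-Reasoning)
open import Relation.Binary.Definitions using (tri<; tri≈; tri>)

prime≥2 : ∀ {p} → Prime p → 2 ≤ p
prime≥2 {p} pp = nonTrivial⇒n>1 p {{prime⇒nonTrivial pp}}

prime-power-cancel : ∀ {p} e x y → Prime p → ¬ p ∣ x → p ^ e ∣ x * y → p ^ e ∣ y
prime-power-cancel zero x y pp p∤x _ = 1∣ y
prime-power-cancel {p} (suc e) x y pp p∤x pe∣xy
  with euclidsLemma x y pp (∣-trans (m∣m*n (p ^ e)) pe∣xy)
... | inj₁ p∣x = ⊥-elim (p∤x p∣x)
... | inj₂ (divides y′ refl) =
  subst (p * p ^ e ∣_) (*-comm p y′) (*-monoʳ-∣ p (prime-power-cancel e x y′ pp p∤x pe∣xy′))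
  where
  instance _ = prime⇒nonZero pp
  regroup : ∀ a b c → a * (b * c) ≡ c * (a * b)
  regroup = solve-∀
  pe∣xy′ : p ^ e ∣ x * y′
  pe∣xy′ = *-cancelˡ-∣ p (subst (p * p ^ e ∣_) (regroup x y′ p) pe∣xy)

binomial-factorial : ∀ n k → k ≤ n → (n C k) * (k ! * (n ∸ k) !) ≡ n !
binomial-factorial n k k≤n =
  trans (cong (_* (k ! * (n ∸ k) !)) (nCk≡n!/k![n-k]! k≤n))
        (m/n*n≡m {{k !* (n ∸ k) !≢0}} (k![n∸k]!∣n! k≤n))

binomial-absorption : ∀ n k → k ≤ n → suc k * (suc n C suc k) ≡ suc n * (n C k)
binomial-absorption n k k≤n = *-cancelʳ-≡ _ _ (k ! * (n ∸ k) !) {{k !* (n ∸ k) !≢0}} scaled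
  where
  open ≡-Reasoning
  regroup : ∀ a b c d → a * b * (c * d) ≡ b * ((a * c) * d)
  regroup = solve-∀
  scaled : suc k * (suc n C suc k) * (k ! * (n ∸ k) !) ≡ suc n * (n C k) * (k ! * (n ∸ k) !)
  scaled = begin
    suc k * (suc n C suc k) * (k ! * (n ∸ k) !)
      ≡⟨ regroup (suc k) (suc n C suc k) (k !) ((n ∸ k) !) ⟩
    (suc n C suc k) * (suc k ! * (n ∸ k) !)
      ≡⟨ binomial-factorial (suc n) (suc k) (s≤s k≤n) ⟩
    suc n * n !
      ≡⟨ cong (suc n *_) (binomial-factorial n k k≤n) ⟨
    suc n * ((n C k) * (k ! * (n ∸ k) !))
      ≡⟨ *-assoc (suc n) (n C k) _ ⟨
    suc n * (n C k) * (k ! * (n ∸ k) !)  ∎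

-- If p^a ∣ n and p ∤ C(n, k) with 0 < k ≤ n, then p^a ∣ k: by absorption,
-- k·C(n, k) = n·C(n−1, k−1) is divisible by p^a.
prime-power∣index : ∀ {p} a n k → Prime p → p ^ a ∣ n → ¬ p ∣ n C k →
                    1 ≤ k → k ≤ n → p ^ a ∣ k
prime-power∣index {p} a (suc n) (suc k) pp pa∣n p∤C _ (s≤s k≤n) =
  prime-power-cancel a (suc n C suc k) (suc k) pp p∤C
    (subst (p ^ a ∣_) (trans (sym (binomial-absorption n k k≤n)) (*-comm (suc k) _))
      (∣m⇒∣m*n (n C k) pa∣n))

prime∤factorial : ∀ {q} i → Prime q → i < q → ¬ q ∣ i !
prime∤factorial zero pq _ q∣1 = <⇒≢ (prime≥2 pq) (sym (∣1⇒≡1 q∣1))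
prime∤factorial (suc i) pq i<q q∣i!
  with euclidsLemma (suc i) (i !) pq q∣i!
... | inj₁ q∣i+1 = <⇒≱ i<q (∣⇒≤ q∣i+1)
... | inj₂ q∣i!′ = prime∤factorial i pq (<-trans (n<1+n i) i<q) q∣i!′

multiple-below-double : ∀ {q x} → q ∣ x → x < 2 * q → x ≡ 0 ⊎ x ≡ q
multiple-below-double (divides zero refl) _ = inj₁ refl
multiple-below-double {q} (divides (suc zero) refl) _ = inj₂ (+-identityʳ q)
multiple-below-double {q} (divides (suc (suc c)) refl) x<2q = ⊥-elim (<⇒≱ x<2q
  (≤-trans (≤-reflexive (cong (q +_) (+-identityʳ q))) (+-monoʳ-≤ q (m≤m+n q (c * q)))))

prime²∤factorial : ∀ {q} j → Prime q → j < 2 * q → ¬ q ^ 2 ∣ j !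
prime²∤factorial {q} zero pq _ q²∣1 =
  <⇒≢ (prime≥2 pq) (sym (∣1⇒≡1 (∣-trans (m∣m*n (q * 1)) q²∣1)))
prime²∤factorial {q} (suc j) pq j<2q q²∣j!
  with q ∣? suc j
... | no q∤j+1 =
  prime²∤factorial j pq (<-trans (n<1+n j) j<2q) (prime-power-cancel 2 (suc j) (j !) pq q∤j+1 q²∣j!)
... | yes q∣j+1 with multiple-below-double q∣j+1 j<2q
...   | inj₂ refl = prime∤factorial j pq (n<1+n j)
          (*-cancelˡ-∣ (suc j) (subst (λ z → suc j * z ∣ suc j * j !) (*-identityʳ (suc j)) q²∣j!))

-- A prime q divides n! at least twice when 2q ≤ n, since q!·q! ∣ (2q)!.
prime²∣factorial : ∀ {q} n → Prime q → 2 * q ≤ n → q ^ 2 ∣ n !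
prime²∣factorial {q@(suc q′)} n pq 2q≤n = ∣-trans q²∣[2q]! (m≤n⇒m!∣n! 2q≤n)
  where
  q∣q! : q ∣ q !
  q∣q! = m∣m*n (q′ !)
  2q∸q≡q : 2 * q ∸ q ≡ q
  2q∸q≡q = trans (m+n∸m≡n q (q + 0)) (+-identityʳ q)
  q!q!∣[2q]! : q ! * q ! ∣ (2 * q) !
  q!q!∣[2q]! = subst (λ z → q ! * z ! ∣ (2 * q) !) 2q∸q≡q (k![n∸k]!∣n! (m≤m+n q (q + 0)))
  q²∣[2q]! : q ^ 2 ∣ (2 * q) !
  q²∣[2q]! = ∣-trans (*-pres-∣ q∣q! (subst (_∣ q !) (sym (*-identityʳ q)) q∣q!)) q!q!∣[2q]!

-- If 2q ≤ n, k < q and n − k < 2q, then q ∣ C(n, k): q² ∣ n! but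
-- q² ∤ k!·(n−k)!, because q ∤ k! and q² ∤ (n−k)!.
prime∣binomial : ∀ {q} n k → Prime q → 2 * q ≤ n → k < q → n ∸ k < 2 * q → q ∣ n C k
prime∣binomial {q} n k pq 2q≤n k<q n∸k<2q with q ∣? (n C k)
... | yes q∣C = q∣C
... | no q∤C = ⊥-elim (prime²∤factorial (n ∸ k) pq n∸k<2q
        (prime-power-cancel 2 (k !) _ pq (prime∤factorial k pq k<q) q²∣k![n∸k]!))
  where
  k≤n : k ≤ n
  k≤n = ≤-trans (<⇒≤ k<q) (≤-trans (m≤m+n q (q + 0)) 2q≤n)
  q²∣k![n∸k]! : q ^ 2 ∣ k ! * (n ∸ k) !
  q²∣k![n∸k]! = prime-power-cancel 2 (n C k) _ pq q∤C
    (subst (q ^ 2 ∣_) (sym (binomial-factorial n k k≤n)) (prime²∣factorial n pq 2q≤n))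

prime∣binomial′ : ∀ {q} n k → Prime q → 2 * q ≤ n → k ≤ n → n ∸ k < q → k < 2 * q → q ∣ n C k
prime∣binomial′ {q} n k pq 2q≤n k≤n n∸k<q k<2q =
  subst (q ∣_) (sym (nCk≡nC[n∸k] k≤n))
    (prime∣binomial n (n ∸ k) pq 2q≤n n∸k<q (subst (_< 2 * q) (sym (m∸[m∸n]≡n k≤n)) k<2q))

multiples-apart : ∀ {d x y} → d ∣ x → d ∣ y → x < y → d ≤ y ∸ x
multiples-apart {d} {x} {y} d∣x d∣y x<y = ∣⇒≤ {{>-nonZero (m<n⇒0<n∸m x<y)}} d∣y∸x
  where
  d∣y∸x : d ∣ y ∸ x
  d∣y∸x = ∣m+n∣m⇒∣n (subst (d ∣_) (sym (m+[n∸m]≡n (<⇒≤ x<y))) d∣y) d∣x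

window-width : ∀ {u v} a s → u ≤ a + s → a ≤ v → u ∸ v ≤ s
window-width {u} {v} a s u≤a+s a≤v = subst (u ∸ v ≤_) (m+n∸m≡n a s) (∸-mono u≤a+s a≤v)

multiples-in-window : ∀ {d x y} a s → s < d → d ∣ x → d ∣ y →
                      a ≤ x → x ≤ a + s → a ≤ y → y ≤ a + s → x ≡ y
multiples-in-window {d} {x} {y} a s s<d d∣x d∣y a≤x x≤a+s a≤y y≤a+s with <-cmp x y
... | tri≈ _ x≡y _ = x≡y
... | tri< x<y _ _ =
  ⊥-elim (<⇒≱ s<d (≤-trans (multiples-apart d∣x d∣y x<y) (window-width a s y≤a+s a≤x)))
... | tri> _ _ y<x =
  ⊥-elim (<⇒≱ s<d (≤-trans (multiples-apart d∣y d∣x y<x) (window-width a s x≤a+s a≤y)))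

∸-below : ∀ {a b n k} → .{{NonZero a}} → a + b ≡ n → b < k → n ∸ k < a
∸-below {a} {b} {n} {k} a+b≡n b<k = m<n+o⇒m∸n<o n k (begin-strict
  n      ≡⟨ a+b≡n ⟨
  a + b  <⟨ +-monoʳ-< a b<k ⟩
  a + k  ≡⟨ +-comm a k ⟩
  k + a  ∎)
  where open ≤-Reasoning

midpoint-in-window : ∀ q s m → 2 * q + s ≡ 2 * m → q ≤ m × m ≤ q + s
midpoint-in-window q s m 2q+s≡2m = *-cancelˡ-≤ 2 2q≤2m , *-cancelˡ-≤ 2 2m≤2[q+s]
  where
  open ≤-Reasoning
  double-sum : ∀ x y → 2 * x + (y + y) ≡ 2 * (x + y)
  double-sum = solve-∀
  2q≤2m : 2 * q ≤ 2 * m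
  2q≤2m = subst (2 * q ≤_) 2q+s≡2m (m≤m+n (2 * q) s)
  2m≤2[q+s] : 2 * m ≤ 2 * (q + s)
  2m≤2[q+s] = begin
    2 * m            ≡⟨ 2q+s≡2m ⟨
    2 * q + s        ≤⟨ +-monoʳ-≤ (2 * q) (m≤n+m s s) ⟩
    2 * q + (s + s)  ≡⟨ double-sum q s ⟩
    2 * (q + s)      ∎

-- Then q ∣ C(2m, k)
-- or k = m: the windows [0, s], [q, q+s], [2q, 2q+s] contain the multiples
-- 0, m, 2m of d and hence no other, while for k strictly between windows
-- one of k, 2m − k is below q and the other below 2q.
q∣binomial-or-midpoint : ∀ {d q} m s k → Prime q → 2 * q + s ≡ 2 * m → s < d →
                         d ∣ m → d ∣ k → 1 ≤ k → k < 2 * m → q ∣ (2 * m) C k ⊎ k ≡ m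
q∣binomial-or-midpoint {d} {q} m s k pq 2q+s≡n s<d d∣m d∣k 1≤k k<n = by-position
  where
  n : ℕ
  n = 2 * m
  instance _ = prime⇒nonZero pq
  instance _ = m*n≢0 2 q
  split-double : ∀ x y → 2 * x + y ≡ x + (x + y)
  split-double = solve-∀
  2q≤n : 2 * q ≤ n
  2q≤n = subst (2 * q ≤_) 2q+s≡n (m≤m+n (2 * q) s)
  n≤2q+s : n ≤ 2 * q + s
  n≤2q+s = ≤-reflexive (sym 2q+s≡n)
  d∣n : d ∣ n
  d∣n = ∣-trans d∣m (n∣m*n 2)
  same-multiple : ∀ {x y} w → d ∣ x → d ∣ y → w ≤ x → x ≤ w + s → w ≤ y → y ≤ w + s → x ≡ y
  same-multiple w = multiples-in-window w s s<d
  by-position : q ∣ n C k ⊎ k ≡ m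
  by-position with k ≤? s
  ... | yes k≤s = ⊥-elim (<⇒≢ 1≤k (same-multiple 0 (divides 0 refl) d∣k z≤n z≤n z≤n k≤s))
  ... | no k≰s with k <? q
  ...   | yes k<q = inj₁ (prime∣binomial n k pq 2q≤n k<q (∸-below 2q+s≡n (≰⇒> k≰s)))
  ...   | no k≮q with k <? 2 * q
  ...     | no k≮2q = ⊥-elim (<⇒≢ k<n
    (same-multiple (2 * q) d∣k d∣n (≮⇒≥ k≮2q) (≤-trans (<⇒≤ k<n) n≤2q+s) 2q≤n n≤2q+s))
  ...     | yes k<2q with k ≤? q + s
  ...       | no k≰q+s = inj₁ (prime∣binomial′ n k pq 2q≤n (<⇒≤ k<n)
    (∸-below (trans (sym (split-double q s)) 2q+s≡n) (≰⇒> k≰q+s)) k<2q)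
  ...       | yes k≤q+s = inj₂ (same-multiple q d∣k d∣m (≮⇒≥ k≮q) k≤q+s q≤m m≤q+s)
    where
    q≤m : q ≤ m
    q≤m = proj₁ (midpoint-in-window q s m 2q+s≡n)
    m≤q+s : m ≤ q + s
    m≤q+s = proj₂ (midpoint-in-window q s m 2q+s≡n)

odd-prime∤2 : ∀ {p} → Prime p → ¬ p ≡ 2 → ¬ p ∣ 2
odd-prime∤2 pp p≢2 p∣2 = p≢2 (≤-antisym (∣⇒≤ p∣2) (prime≥2 pp))

-- Theorem 4.1.  If p ∤ C(n, k), then p^a ∣ k and p^a ∣ m (p is odd), so the
-- core lemma with d = p^a gives q ∣ C(n, k) or k = m, where r ∣ C(n, m).
theorem4p1 : (m : ℕ) → 1 ≤ m →
    (p a q r : ℕ) → Prime p → ¬ (p ≡ 2) →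
    p ^ a ∣ (2 * m) → ¬ (p ^ suc a ∣ (2 * m)) →
    Prime q → 2 * m < 3 * q → 2 * q < 2 * m → (2 * m) ∸ 2 * q < p ^ a →
    Prime r → r ∣ ((2 * m) C m) →
    (k : ℕ) → 1 ≤ k → k ≤ (2 * m) ∸ 1 →
    (p ∣ ((2 * m) C k)) ⊎ (q ∣ ((2 * m) C k)) ⊎ (r ∣ ((2 * m) C k))
theorem4p1 m _ p a q r pp p≢2 pa∣2m _ pq _ 2q<2m s<pa _ r∣C k 1≤k k≤2m∸1
  with p ∣? ((2 * m) C k)
... | yes p∣C = inj₁ p∣C
... | no p∤C
  with q∣binomial-or-midpoint m (2 * m ∸ 2 * q) k pq (m+[n∸m]≡n (<⇒≤ 2q<2m)) s<pa
         (prime-power-cancel a 2 m pp (odd-prime∤2 pp p≢2) pa∣2m)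
         (prime-power∣index a (2 * m) k pp pa∣2m p∤C 1≤k (<⇒≤ k<2m)) 1≤k k<2m
  where
  k<2m : k < 2 * m
  k<2m = ≤-<-trans k≤2m∸1 (∸-monoʳ-< {2 * m} {1} {0} (s≤s z≤n) (≤-trans (s≤s z≤n) 2q<2m))
...   | inj₁ q∣C = inj₂ (inj₁ q∣C)
...   | inj₂ refl = inj₂ (inj₂ r∣C)
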